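{- Let $m$ be a positive integer and let $\Gamma=\mathrm{Cay}(\mathbb{Z}_{2m},S)$ be a circulant graph. Then $\Gamma$ is unstable if any of the following conditions holds: (i) there exist a subgroup $K$ of $\mathbb{Z}_{2m}$ of even order and a nontrivial subgroup $H$ of $K$ of odd order such that $(S\setminus K_o)+H=S\setminus K_o$, where $K_o=K\setminus 2K$; (ii) $\Gamma\cong\mathrm{Cay}(\mathbb{Z}_{2m},S+m)$; (iii) $\mathrm{Cay}\big(\mathbb{Z}_{2m},(S\setminus\{m\})+m\big)$ has an automorphism fixing $0$ but moving $m$.
   Context: For an additive group $G$ and an inverse-closed subset $S\subseteq G\setminus\{0\}$, the Cayley graph $\mathrm{Cay}(G,S)$ has vertex set $G$, with $x\sim y$ iff $y-x\in S$. For subsets $A,B$ of $G$ and $g\in G$, $A+B=\{a+b:a\in A,b\in B\}$, $A+g=\{a+g:a\in A\}$, and $2K=\{2k:k\in K\}$. A graph $\Lambda$ is stable if $\mathrm{Aut}(\Lambda\times K_2)=\mathrm{Aut}(\Lambda)\times\mathrm{Aut}(K_2)$, where $\Lambda\times K_2$ is the direct product (vertex set $V(\Lambda)\times V(K_2)$, $(a,x)\sim(b,y)$ iff $a\sim b$ and $x\sim y$) on which $\mathrm{Aut}(\Lambda)\times\mathrm{Aut}(K_2)$ acts coordinatewise; otherwise $\Lambda$ is unstable. -}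

module Defs where

open import Level using (0ℓ)
open import Data.Nat using (ℕ; zero; suc; _+_; _*_; _∸_; NonZero)
open import Data.Nat.Properties using (m*n≢0)
open import Data.Nat.DivMod using (_mod_)
open import Data.Nat.Divisibility using (_∣_)
open import Data.Fin using (Fin; toℕ)
open import Data.Fin.Subset using (Subset; _∈_; _∉_; _⊆_; ∣_∣)
open import Data.Bool using (Bool)
open import Data.Product using (Σ; ∃; ∃-syntax; _×_; _,_)
open import Function.Bundles using (_↔_; _⇔_; Inverse)
open import Relation.Nullary using (¬_)
open import Relation.Binary.PropositionalEquality using (_≡_; _≢_)

record Aut {V : Set} (E : V → V → Set) : Set where
  field
    perm     : V ↔ V
    preserve : ∀ u v → E u v ⇔ E (Inverse.to perm u) (Inverse.to perm v)

record Iso {V : Set} (E E' : V → V → Set) : Set where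
  field
    perm     : V ↔ V
    preserve : ∀ u v → E u v ⇔ E' (Inverse.to perm u) (Inverse.to perm v)

K₂ : Bool → Bool → Set
K₂ x y = x ≢ y

_×K₂ : {V : Set} → (V → V → Set) → (V × Bool → V × Bool → Set)
(E ×K₂) (a , x) (b , y) = E a b × K₂ x y

Stable : {V : Set} → (V → V → Set) → Set
Stable E =
  (g : Aut (E ×K₂)) →
  Σ (Aut E) λ σ → Σ (Aut K₂) λ τ → (∀ a x →
    Inverse.to (Aut.perm g) (a , x)
      ≡ (Inverse.to (Aut.perm σ) a , Inverse.to (Aut.perm τ) x))

Unstable : {V : Set} → (V → V → Set) → Set
Unstable E = ¬ Stable E

ℤ₂ₘ : ℕ → Set
ℤ₂ₘ m = Fin (2 * m)

module _ (m : ℕ) .{{_ : NonZero m}} where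
  private instance
    nz : NonZero (2 * m)
    nz = m*n≢0 2 m

  ⟦_⟧ : ℕ → ℤ₂ₘ m
  ⟦ k ⟧ = k mod (2 * m)

  0ₘ : ℤ₂ₘ m
  0ₘ = ⟦ 0 ⟧

  mₘ : ℤ₂ₘ m
  mₘ = ⟦ m ⟧

  add : ℤ₂ₘ m → ℤ₂ₘ m → ℤ₂ₘ m
  add x y = ⟦ toℕ x + toℕ y ⟧

  neg : ℤ₂ₘ m → ℤ₂ₘ m
  neg x = ⟦ 2 * m ∸ toℕ x ⟧

  sub : ℤ₂ₘ m → ℤ₂ₘ m → ℤ₂ₘ m
  sub y x = add y (neg x)

  Cay : (ℤ₂ₘ m → Set) → ℤ₂ₘ m → ℤ₂ₘ m → Set
  Cay T x y = T (sub y x)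

  CayS : Subset (2 * m) → ℤ₂ₘ m → ℤ₂ₘ m → Set
  CayS S = Cay (_∈ S)

  ConnectionSet : Subset (2 * m) → Set
  ConnectionSet S = (0ₘ ∉ S) × (∀ s → s ∈ S → neg s ∈ S)

  IsSubgroup : Subset (2 * m) → Set
  IsSubgroup K =
    (0ₘ ∈ K) × (∀ x y → x ∈ K → y ∈ K → add x y ∈ K) × (∀ x → x ∈ K → neg x ∈ K)

  Double : Subset (2 * m) → ℤ₂ₘ m → Set
  Double K x = ∃[ k ] (k ∈ K × x ≡ add k k)

  Kₒ : Subset (2 * m) → ℤ₂ₘ m → Set
  Kₒ K x = x ∈ K × ¬ Double K x

  SminusKₒ : Subset (2 * m) → Subset (2 * m) → ℤ₂ₘ m → Set
  SminusKₒ S K x = x ∈ S × ¬ Kₒ K x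

  _⊕_ : (ℤ₂ₘ m → Set) → Subset (2 * m) → ℤ₂ₘ m → Set
  (A ⊕ H) x = ∃[ a ] ∃[ h ] (A a × h ∈ H × x ≡ add a h)

  Shift : (ℤ₂ₘ m → Set) → ℤ₂ₘ m → Set
  Shift A x = ∃[ a ] (A a × x ≡ add a mₘ)

  RemoveM : Subset (2 * m) → ℤ₂ₘ m → Set
  RemoveM S x = x ∈ S × x ≢ mₘ

  Cond1 : Subset (2 * m) → Set
  Cond1 S =
    ∃[ K ] ∃[ H ]
      ( IsSubgroup K × 2 ∣ ∣ K ∣
      × IsSubgroup H × H ⊆ K × ¬ (2 ∣ ∣ H ∣) × (∃[ h ] (h ∈ H × h ≢ 0ₘ))
      × (∀ x → (SminusKₒ S K ⊕ H) x ⇔ SminusKₒ S K x) )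

  Cond2 : Subset (2 * m) → Set
  Cond2 S = Iso (CayS S) (Cay (Shift (_∈ S)))

  Cond3 : Subset (2 * m) → Set
  Cond3 S =
    Σ (Aut (Cay (Shift (RemoveM S)))) λ σ →
      ( Inverse.to (Aut.perm σ) 0ₘ ≡ 0ₘ
      × Inverse.to (Aut.perm σ) mₘ ≢ mₘ )

-- Each condition yields a two-fold automorphism (α, β) of Γ = Cay(ℤ₂ₘ, S), i.e. permutations
-- with a ∼ b ⇔ α a ∼ β b, such that α ≠ β. Then (a, 0) ↦ (α a, 0), (a, 1) ↦ (β a, 1) is an
-- automorphism of Γ × K₂ that does not act coordinatewise, so Γ is unstable.
-- Since m = -m, a ∼ b in Cay(S + m) iff a ∼ b + m in Cay(S). Hence an isomorphism
-- φ : Cay(S) → Cay(S + m) gives (φ, φ + m) in case (ii). In case (iii) the automorphism σ of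
-- Cay((S ∖ {m}) + m) is one of Cay(S + m) as well (the two graphs differ only by loops), and
-- (σ, σ(· + m) + m) differs at 0 because σ fixes 0 and moves m.
-- In case (i), K is generated by a divisor d of 2m with |K| = 2m/d even, so the parity ε a of
-- the block index ⌊a/d⌋ is well defined; adding an element of K_o flips ε, while H ⊆ 2K
-- (as |H| is odd) preserves it. Let α, resp. β, add a fixed h ∈ H ∖ {0} exactly where ε = 0,
-- resp. ε = 1. Then β b - α a = b - a when ε a ≠ ε b, and β b - α a = b - a ± h when ε a = ε b;
-- in the latter case neither difference lies in K_o, and S ∖ K_o is H-invariant.

module Submission where

open import Defs
open import Level using (0ℓ)
open import Algebra.Bundles using (AbelianGroup)
open import Algebra.Structures using (IsAbelianGroup)
open import Algebra.Consequences.Propositional using (comm∧idʳ⇒id; comm∧invʳ⇒inv)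
import Algebra.Properties.AbelianGroup as AbelianGroupProperties
import Algebra.Properties.CommutativeSemigroup as CommutativeSemigroupProperties
open import Data.Bool using (Bool; true; false)
open import Data.Empty using (⊥-elim)
open import Data.Fin using (toℕ; zero; suc; _≟_)
open import Data.Fin.Properties using (toℕ-injective; toℕ-fromℕ<; toℕ<n)
open import Data.Fin.Subset using (Subset; _∈_; _⊆_; ∣_∣; inside; outside)
open import Data.Fin.Subset.Properties using (_∈?_)
open import Data.Nat using (ℕ; zero; suc; NonZero; _*_; _∸_; _%_; _/_; _<_; _≤_; _<?_; z≤n; s≤s; pred; parity; >-nonZero; >-nonZero⁻¹; ≢-nonZero⁻¹)
open import Data.Nat.DivMod using (m%n<n; m<n⇒m%n≡m; n%n≡0; %-distribˡ-+; m≡m%n+[m/n]*n; m*n/n≡m; +-distrib-/-∣ʳ)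
open import Data.Nat.Divisibility using (_∣_; _∣?_; divides; divides-refl; ∣-refl; ∣m∣n⇒∣m+n; ∣m+n∣m⇒∣n; ∣⇒≤; n∣m*n; m%n≡0⇒n∣m; _∣0)
open import Data.Nat.Induction using (<-rec)
open import Data.Nat.Properties using (anyUpTo?; m*n≢0; m*n≢0⇒n≢0; +-assoc; +-comm; +-suc; +-identityʳ; *-comm; *-assoc; *-cancelʳ-≡; m<m*n; m<m+n; m+[n∸m]≡n; suc-pred; <⇒≤; <⇒≱; <-≤-trans; ≤-trans; ≤-reflexive)
open import Data.Parity.Base as ℙ using (Parity; 0ℙ; 1ℙ; _⁻¹)
open import Data.Parity.Properties using (p≢p⁻¹; *-zeroʳ) renaming (_≟_ to _≟ℙ_; +-comm to ℙ+-comm; +-identityʳ to ℙ+-identityʳ)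
open import Data.Parity.Properties using (+-homo-+; *-homo-*)
open import Data.Product using (∃-syntax; _×_; _,_; proj₁; proj₂)
open import Data.Sum using (_⊎_; inj₁; inj₂)
import Data.Sum as Sum
open import Data.Vec.Base using ([]; _∷_; here; there)
open import Function.Base using (_∘_)
open import Function.Bundles using (_↔_; _⇔_; Inverse; Injection; Equivalence; mk↔ₛ′; mk⇔)
open import Function.Construct.Composition using (_↔-∘_)
open import Function.Construct.Symmetry using (⇔-sym)
open import Function.Properties.Equivalence using () renaming (refl to ⇔-refl; trans to ⇔-trans)
open import Function.Properties.Inverse using (↔⇒↣)
open import Relation.Binary.Definitions using (Symmetric; DecidableEquality)
open import Relation.Binary.PropositionalEquality using (_≡_; _≢_; refl; sym; trans; cong; cong₂; subst; isEquivalence; module ≡-Reasoning)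
open import Relation.Nullary using (¬_; yes; no)
open import Relation.Nullary.Decidable using (_×-dec_)
open import Relation.Unary using (Decidable)

-- Arithmetic of ℕ

Least : (ℕ → Set) → ℕ → Set
Least P d = P d × ∀ {j} → j < d → ¬ P j

least-witness : {P : ℕ → Set} → Decidable P → ∀ {k} → P k → ∃[ d ] Least P d
least-witness {P} P? {k} = <-rec (λ k → P k → ∃[ d ] Least P d) search k
  where
    search : ∀ k → (∀ {j} → j < k → P j → ∃[ d ] Least P d) → P k → ∃[ d ] Least P d
    search k smaller Pk with anyUpTo? P? k
    ... | yes (j , j<k , Pj) = smaller j<k Pj
    ... | no  none-below     = k , Pk , λ j<k Pj → none-below (_ , j<k , Pj)

2∣⇒parity≡0ℙ : ∀ {k} → 2 ∣ k → parity k ≡ 0ℙ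
2∣⇒parity≡0ℙ (divides-refl q) = trans (*-homo-* q 2) (*-zeroʳ (parity q))

parity≡0ℙ⇒2∣ : ∀ k → parity k ≡ 0ℙ → 2 ∣ k
parity≡0ℙ⇒2∣ zero          _        = 2 ∣0
parity≡0ℙ⇒2∣ (suc (suc k)) parity≡0 = ∣m∣n⇒∣m+n ∣-refl (parity≡0ℙ⇒2∣ k parity≡0)

2∤⇒parity≡1ℙ : ∀ {k} → ¬ 2 ∣ k → parity k ≡ 1ℙ
2∤⇒parity≡1ℙ {k} 2∤k with parity k in eq
... | 0ℙ = ⊥-elim (2∤k (parity≡0ℙ⇒2∣ k eq))
... | 1ℙ = refl

module Multiples (d : ℕ) .{{_ : NonZero d}} where

  open import Data.Nat using (_+_)

  multiplesIn : ℕ → ℕ → ℕ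
  multiplesIn o zero    = 0
  multiplesIn o (suc k) with d ∣? o
  ... | yes _ = suc (multiplesIn (suc o) k)
  ... | no  _ = multiplesIn (suc o) k

  private
    tail-membership : ∀ {k o x} {p : Subset k} → (∀ i → i ∈ x ∷ p ⇔ d ∣ o + toℕ i) →
                      ∀ i → i ∈ p ⇔ d ∣ suc o + toℕ i
    tail-membership {o = o} mem i = mk⇔
      (λ i∈p → subst (d ∣_) (+-suc o (toℕ i)) (Equivalence.to (mem (suc i)) (there i∈p)))
      (λ d∣ → drop-there (Equivalence.from (mem (suc i)) (subst (d ∣_) (sym (+-suc o (toℕ i))) d∣)))
      where
        drop-there : ∀ {k x i} {p : Subset k} → suc i ∈ x ∷ p → i ∈ p
        drop-there (there i∈p) = i∈p

  ∣∣≡multiplesIn : ∀ {k} o (p : Subset k) → (∀ i → i ∈ p ⇔ d ∣ o + toℕ i) → ∣ p ∣ ≡ multiplesIn o k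
  ∣∣≡multiplesIn o []      mem = refl
  ∣∣≡multiplesIn o (x ∷ p) mem with d ∣? o | x
  ... | yes _   | inside  = cong suc (∣∣≡multiplesIn (suc o) p (tail-membership mem))
  ... | no  _   | outside = ∣∣≡multiplesIn (suc o) p (tail-membership mem)
  ... | yes d∣o | outside with () ← Equivalence.from (mem zero) (subst (d ∣_) (sym (+-identityʳ o)) d∣o)
  ... | no  d∤o | inside  = ⊥-elim (d∤o (subst (d ∣_) (+-identityʳ o) (Equivalence.to (mem zero) here)))

  multiplesIn-+ : ∀ o a b → multiplesIn o (a + b) ≡ multiplesIn o a + multiplesIn (o + a) b
  multiplesIn-+ o zero    b = cong (λ o′ → multiplesIn o′ b) (sym (+-identityʳ o))
  multiplesIn-+ o (suc a) b with d ∣? o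
  ... | yes _ = cong suc (trans (multiplesIn-+ (suc o) a b) (cong (λ o′ → multiplesIn (suc o) a + multiplesIn o′ b) (sym (+-suc o a))))
  ... | no  _ = trans (multiplesIn-+ (suc o) a b) (cong (λ o′ → multiplesIn (suc o) a + multiplesIn o′ b) (sym (+-suc o a)))

  multiplesIn-gap : ∀ q s t → 0 < s → s + t ≤ d → multiplesIn (q * d + s) t ≡ 0
  multiplesIn-gap q s zero    _   _     = refl
  multiplesIn-gap q s (suc t) 0<s s+t≤d with d ∣? (q * d + s)
  ... | yes d∣qd+s = ⊥-elim (<⇒≱ s<d (∣⇒≤ {{>-nonZero 0<s}} (∣m+n∣m⇒∣n d∣qd+s (n∣m*n q))))
    where
      s<d : s < d
      s<d = <-≤-trans (m<m+n s (s≤s z≤n)) s+t≤d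
  ... | no  _ = trans (cong (λ o → multiplesIn o t) (sym (+-suc (q * d) s)))
                      (multiplesIn-gap q (suc s) t (s≤s z≤n) (≤-trans (≤-reflexive (sym (+-suc s t))) s+t≤d))

  multiplesIn-period : ∀ q → multiplesIn (q * d) d ≡ 1
  multiplesIn-period q = begin
    multiplesIn (q * d) d                                    ≡⟨ cong (multiplesIn (q * d)) (sym (suc-pred d)) ⟩
    multiplesIn (q * d) (1 + pred d)                         ≡⟨ multiplesIn-+ (q * d) 1 (pred d) ⟩
    multiplesIn (q * d) 1 + multiplesIn (q * d + 1) (pred d) ≡⟨ cong₂ _+_ first-is-multiple
                                                                  (multiplesIn-gap q 1 (pred d) (s≤s z≤n) (≤-reflexive (suc-pred d))) ⟩
    1                                                        ∎
    where
      open ≡-Reasoning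
      first-is-multiple : multiplesIn (q * d) 1 ≡ 1
      first-is-multiple with d ∣? (q * d)
      ... | yes _   = refl
      ... | no d∤qd = ⊥-elim (d∤qd (n∣m*n q))

  multiplesIn-periods : ∀ N q → multiplesIn (q * d) (N * d) ≡ N
  multiplesIn-periods zero    q = refl
  multiplesIn-periods (suc N) q = begin
    multiplesIn (q * d) (d + N * d)                         ≡⟨ multiplesIn-+ (q * d) d (N * d) ⟩
    multiplesIn (q * d) d + multiplesIn (q * d + d) (N * d) ≡⟨ cong₂ _+_ (multiplesIn-period q)
                                                                 (cong (λ o → multiplesIn o (N * d)) (+-comm (q * d) d)) ⟩
    1 + multiplesIn (suc q * d) (N * d)                     ≡⟨ cong suc (multiplesIn-periods N (suc q)) ⟩
    suc N                                                   ∎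
    where open ≡-Reasoning

  ∣multiples∣ : ∀ {k} N → k ≡ N * d → (p : Subset k) → (∀ i → i ∈ p ⇔ d ∣ toℕ i) → ∣ p ∣ ≡ N
  ∣multiples∣ N k≡Nd p mem =
    trans (∣∣≡multiplesIn 0 p mem) (trans (cong (multiplesIn 0) k≡Nd) (multiplesIn-periods N 0))

-- Two-fold automorphisms

record TwoFoldAut {V : Set} (E : V → V → Set) : Set where
  field
    α β      : V ↔ V
    preserve : ∀ a b → E a b ⇔ E (Inverse.to α a) (Inverse.to β b)

module _ {V : Set} {E : V → V → Set} (E-sym : Symmetric E) (t : TwoFoldAut E) where
  open TwoFoldAut t

  private
    layer : Bool → V ↔ V
    layer false = α
    layer true  = β

    lift : V × Bool → V × Bool
    lift (a , x) = Inverse.to (layer x) a , x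

    unlift : V × Bool → V × Bool
    unlift (a , x) = Inverse.from (layer x) a , x

    preserve-across : ∀ x y a b → K₂ x y → E a b ⇔ E (Inverse.to (layer x) a) (Inverse.to (layer y) b)
    preserve-across false false a b x≢y = ⊥-elim (x≢y refl)
    preserve-across true  true  a b x≢y = ⊥-elim (x≢y refl)
    preserve-across false true  a b _   = preserve a b
    preserve-across true  false a b _   =
      mk⇔ (λ e → E-sym (Equivalence.to (preserve b a) (E-sym e)))
          (λ e → E-sym (Equivalence.from (preserve b a) (E-sym e)))

  twoFoldAut⇒aut×K₂ : Aut (E ×K₂)
  twoFoldAut⇒aut×K₂ = record
    { perm     = mk↔ₛ′ lift unlift
                   (λ (a , x) → cong (_, x) (Inverse.strictlyInverseˡ (layer x) a))
                   (λ (a , x) → cong (_, x) (Inverse.strictlyInverseʳ (layer x) a))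
    ; preserve = λ (a , x) (b , y) → mk⇔
                   (λ (e , x≢y) → Equivalence.to   (preserve-across x y a b x≢y) e , x≢y)
                   (λ (e , x≢y) → Equivalence.from (preserve-across x y a b x≢y) e , x≢y)
    }

  twoFoldAut⇒unstable : ∀ a → Inverse.to α a ≢ Inverse.to β a → Unstable E
  twoFoldAut⇒unstable a α≢β stable with stable twoFoldAut⇒aut×K₂
  ... | _ , _ , coordinatewise =
    α≢β (trans (cong proj₁ (coordinatewise a false)) (sym (cong proj₁ (coordinatewise a true))))

aut-ignoring-loops : {V : Set} {E E′ : V → V → Set} → DecidableEquality V →
  (∀ u v → u ≢ v → E u v ⇔ E′ u v) → (∀ u v → E u u ⇔ E v v) → Aut E′ → Aut E
aut-ignoring-loops {V} {E} _≟_ off-diagonal loops σ = record { perm = perm ; preserve = preserve }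
  where
    open Aut σ using (perm)

    σ⟨_⟩ : V → V
    σ⟨_⟩ = Inverse.to perm

    preserve : ∀ u v → E u v ⇔ E σ⟨ u ⟩ σ⟨ v ⟩
    preserve u v with u ≟ v
    ... | yes refl = loops u σ⟨ u ⟩
    ... | no u≢v   = ⇔-trans (off-diagonal u v u≢v)
                       (⇔-trans (Aut.preserve σ u v)
                         (⇔-sym (off-diagonal σ⟨ u ⟩ σ⟨ v ⟩ (u≢v ∘ Injection.injective (↔⇒↣ perm)))))

-- Cayley graphs on abelian groups

module CayleyGraphs {G : Set} {add : G → G → G} {0# : G} {neg : G → G}
                    (isAbelianGroup : IsAbelianGroup _≡_ add 0# neg) where

  open IsAbelianGroup isAbelianGroup using (_-_; assoc; comm; identityˡ; identityʳ; inverseʳ)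

  infixl 6 _+_
  infix  8 -_

  _+_ : G → G → G
  _+_ = add

  -_ : G → G
  -_ = neg

  private
    abelianGroup : AbelianGroup 0ℓ 0ℓ
    abelianGroup = record { isAbelianGroup = isAbelianGroup }

  open AbelianGroupProperties abelianGroup
    using (⁻¹-anti-homo‿-; ⁻¹-∙-comm; //-rightDividesˡ; //-rightDividesʳ; identityʳ-unique; ε⁻¹≈ε; x∙y⁻¹≈ε⇒x≈y; ∙-cancelˡ)
  open CommutativeSemigroupProperties (AbelianGroup.commutativeSemigroup abelianGroup) using (interchange)

  Cayley : (G → Set) → G → G → Set
  Cayley T x y = T (y - x)

  Shifted : (G → Set) → G → G → Set
  Shifted T ι x = ∃[ a ] (T a × x ≡ a + ι)

  _∖⁅_⁆ : (G → Set) → G → G → Set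
  (T ∖⁅ ι ⁆) x = T x × x ≢ ι

  Cayley-sym : ∀ {T} → (∀ s → T s → T (- s)) → Symmetric (Cayley T)
  Cayley-sym {T} T-inv {x} {y} e = subst T (⁻¹-anti-homo‿- y x) (T-inv (y - x) e)

  Cayley-loop : ∀ T u v → Cayley T u u ⇔ Cayley T v v
  Cayley-loop T u v = subst (λ w → T (u - u) ⇔ T w) (trans (inverseʳ u) (sym (inverseʳ v))) ⇔-refl

  module _ (ι : G) (ι+ι≡0 : ι + ι ≡ 0#) where

    +ι-involutive : ∀ x → x + ι + ι ≡ x
    +ι-involutive x = trans (assoc x ι ι) (trans (cong (x +_) ι+ι≡0) (identityʳ x))

    +ι↔ : G ↔ G
    +ι↔ = mk↔ₛ′ (_+ ι) (_+ ι) +ι-involutive +ι-involutive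

    Cayley-Shifted : ∀ T u v → Cayley (Shifted T ι) u v ⇔ Cayley T u (v + ι)
    Cayley-Shifted T u v = mk⇔
      (λ (a , Ta , v-u≡a+ι) → subst T (sym (trans gap (trans (cong (_+ ι) v-u≡a+ι) (+ι-involutive a)))) Ta)
      (λ T[v+ι-u] → (v + ι) - u , T[v+ι-u] , trans (sym (+ι-involutive (v - u))) (cong (_+ ι) (sym gap)))
      where
        gap : (v + ι) - u ≡ (v - u) + ι
        gap = trans (assoc v ι (- u)) (trans (cong (v +_) (comm ι (- u))) (sym (assoc v (- u) ι)))

    module _ {T : G → Set} where

      twoFoldAut-via-Shifted : (α β : G ↔ G) →
        (∀ a b → Cayley T a b ⇔ Cayley (Shifted T ι) (Inverse.to α a) (Inverse.to β b)) →
        TwoFoldAut (Cayley T)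
      twoFoldAut-via-Shifted α β preserve = record
        { α        = α
        ; β        = +ι↔ ↔-∘ β
        ; preserve = λ a b → ⇔-trans (preserve a b) (Cayley-Shifted T _ _)
        }

      iso⇒twoFoldAut : Iso (Cayley T) (Cayley (Shifted T ι)) → TwoFoldAut (Cayley T)
      iso⇒twoFoldAut φ = twoFoldAut-via-Shifted (Iso.perm φ) (Iso.perm φ) (Iso.preserve φ)

      aut⇒twoFoldAut : Aut (Cayley (Shifted T ι)) → TwoFoldAut (Cayley T)
      aut⇒twoFoldAut σ = twoFoldAut-via-Shifted (Aut.perm σ) (Aut.perm σ ↔-∘ +ι↔) preserve
        where
          preserve : ∀ a b → Cayley T a b ⇔ Cayley (Shifted T ι) (Inverse.to (Aut.perm σ) a) (Inverse.to (Aut.perm σ) (b + ι))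
          preserve a b = ⇔-trans (subst (λ w → Cayley T a b ⇔ Cayley T a w) (sym (+ι-involutive b)) ⇔-refl)
                           (⇔-trans (⇔-sym (Cayley-Shifted T a (b + ι))) (Aut.preserve σ a (b + ι)))

      Shifted-offDiagonal : ∀ u v → u ≢ v → Cayley (Shifted T ι) u v ⇔ Cayley (Shifted (T ∖⁅ ι ⁆) ι) u v
      Shifted-offDiagonal u v u≢v = mk⇔
        (λ (a , Ta , v-u≡a+ι) → a , (Ta , λ a≡ι → u≢v (sym (x∙y⁻¹≈ε⇒x≈y v u (trans v-u≡a+ι (trans (cong (_+ ι) a≡ι) ι+ι≡0))))) , v-u≡a+ι)
        (λ (a , (Ta , _) , v-u≡a+ι) → a , Ta , v-u≡a+ι)

      module _ (T-inv : ∀ s → T s → T (- s)) where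

        iso-Shifted⇒unstable : ι ≢ 0# → Iso (Cayley T) (Cayley (Shifted T ι)) → Unstable (Cayley T)
        iso-Shifted⇒unstable ι≢0 φ = twoFoldAut⇒unstable (Cayley-sym T-inv) (iso⇒twoFoldAut φ) 0#
          (λ e → ι≢0 (identityʳ-unique _ ι (sym e)))

        aut-Shifted⇒unstable : DecidableEquality G → (σ : Aut (Cayley (Shifted (T ∖⁅ ι ⁆) ι))) →
          Inverse.to (Aut.perm σ) 0# ≡ 0# → Inverse.to (Aut.perm σ) ι ≢ ι → Unstable (Cayley T)
        aut-Shifted⇒unstable _≟_ σ σ0≡0 σι≢ι = twoFoldAut⇒unstable (Cayley-sym T-inv) (aut⇒twoFoldAut σ′) 0#
          λ σ0≡σ[0+ι]+ι → σι≢ι (begin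
            σ⟨ ι ⟩              ≡⟨ cong σ⟨_⟩ (identityˡ ι) ⟨
            σ⟨ 0# + ι ⟩         ≡⟨ +ι-involutive σ⟨ 0# + ι ⟩ ⟨
            σ⟨ 0# + ι ⟩ + ι + ι ≡⟨ cong (_+ ι) (trans (sym σ0≡σ[0+ι]+ι) σ0≡0) ⟩
            0# + ι              ≡⟨ identityˡ ι ⟩
            ι                   ∎)
          where
            σ′ : Aut (Cayley (Shifted T ι))
            σ′ = aut-ignoring-loops _≟_ Shifted-offDiagonal (Cayley-loop (Shifted T ι)) σ
            σ⟨_⟩ : G → G
            σ⟨_⟩ = Inverse.to (Aut.perm σ)
            open ≡-Reasoning

  module _ {S X : G → Set} (S-inv : ∀ s → S s → S (- s))
           (ε : G → Parity) (X-flips-ε : ∀ a x → X x → ε (a + x) ≢ ε a)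
           (h : G) (h≢0 : h ≢ 0#) (h-preserves-ε : ∀ a → ε (a + h) ≡ ε a)
           (S-+h : ∀ x → ¬ X x → ¬ X (x + h) → S x ⇔ S (x + h)) where

    private
      δ : Parity → G
      δ 0ℙ = h
      δ 1ℙ = 0#

      ε-twist : ∀ p a → ε (a + δ p) ≡ ε a
      ε-twist 0ℙ a = h-preserves-ε a
      ε-twist 1ℙ a = cong ε (identityʳ a)

      ε-untwist : ∀ p a → ε (a - δ p) ≡ ε a
      ε-untwist p a = trans (sym (ε-twist p (a - δ p))) (cong ε (//-rightDividesˡ (δ p) a))

      -- twist p adds h exactly at the points a with ε a ≡ p
      twist : Parity → G ↔ G
      twist p = mk↔ₛ′ (λ a → a + δ (p ℙ.+ ε a)) (λ a → a - δ (p ℙ.+ ε a))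
        (λ a → trans (cong (λ q → (a - δ (p ℙ.+ ε a)) + δ (p ℙ.+ q)) (ε-untwist (p ℙ.+ ε a) a))
                     (//-rightDividesˡ (δ (p ℙ.+ ε a)) a))
        (λ a → trans (cong (λ q → (a + δ (p ℙ.+ ε a)) - δ (p ℙ.+ q)) (ε-twist (p ℙ.+ ε a) a))
                     (//-rightDividesʳ (δ (p ℙ.+ ε a)) a))

      α β : G ↔ G
      α = twist 0ℙ
      β = twist 1ℙ

      α⟨_⟩ β⟨_⟩ : G → G
      α⟨_⟩ = Inverse.to α
      β⟨_⟩ = Inverse.to β

      gap : ∀ a b u v → (b + u) - (a + v) ≡ (b - a) + (u - v)
      gap a b u v = trans (cong ((b + u) +_) (sym (⁻¹-∙-comm a v))) (interchange b u (- a) (- v))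

      δ-gap-≢ : ∀ p q → p ≢ q → δ (q ⁻¹) ≡ δ p
      δ-gap-≢ 0ℙ 0ℙ p≢q = ⊥-elim (p≢q refl)
      δ-gap-≢ 0ℙ 1ℙ _   = refl
      δ-gap-≢ 1ℙ 0ℙ _   = refl
      δ-gap-≢ 1ℙ 1ℙ p≢q = ⊥-elim (p≢q refl)

      δ-gap-≡ : ∀ p → (δ (p ⁻¹) - δ p ≡ h) ⊎ (δ (p ⁻¹) - δ p ≡ - h)
      δ-gap-≡ 0ℙ = inj₂ (identityˡ (- h))
      δ-gap-≡ 1ℙ = inj₁ (trans (cong (h +_) ε⁻¹≈ε) (identityʳ h))

      δ-distinct : ∀ p → δ p ≢ δ (p ⁻¹)
      δ-distinct 0ℙ = h≢0
      δ-distinct 1ℙ = h≢0 ∘ sym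

      ¬X-between : ∀ u v → ε u ≡ ε v → ¬ X (v - u)
      ¬X-between u v εu≡εv Xv-u = X-flips-ε u (v - u) Xv-u
        (trans (cong ε (trans (comm u (v - u)) (//-rightDividesˡ u v))) (sym εu≡εv))

      S-step : ∀ x y → ¬ X x → ¬ X y → (y ≡ x + h) ⊎ (y ≡ x - h) → S x ⇔ S y
      S-step x y ¬Xx ¬Xy (inj₁ y≡x+h) =
        subst (λ w → S x ⇔ S w) (sym y≡x+h) (S-+h x ¬Xx (subst (λ w → ¬ X w) y≡x+h ¬Xy))
      S-step x y ¬Xx ¬Xy (inj₂ y≡x-h) =
        ⇔-sym (subst (λ w → S y ⇔ S w) y+h≡x (S-+h y ¬Xy (subst (λ w → ¬ X w) (sym y+h≡x) ¬Xx)))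
        where
          y+h≡x : y + h ≡ x
          y+h≡x = trans (cong (_+ h) y≡x-h) (//-rightDividesˡ h x)

      preserve : ∀ a b → Cayley S a b ⇔ Cayley S α⟨ a ⟩ β⟨ b ⟩
      preserve a b with ε a ≟ℙ ε b
      ... | no εa≢εb = subst (λ w → S (b - a) ⇔ S w) (sym (begin
              β⟨ b ⟩ - α⟨ a ⟩                              ≡⟨ gap a b _ _ ⟩
              (b - a) + (δ (ε b ⁻¹) - δ (ε a))             ≡⟨ cong (λ u → (b - a) + (u - δ (ε a))) (δ-gap-≢ (ε a) (ε b) εa≢εb) ⟩
              (b - a) + (δ (ε a) - δ (ε a))                ≡⟨ cong ((b - a) +_) (inverseʳ (δ (ε a))) ⟩
              (b - a) + 0#                                 ≡⟨ identityʳ (b - a) ⟩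
              b - a                                        ∎)) ⇔-refl
        where open ≡-Reasoning
      ... | yes εa≡εb = S-step (b - a) (β⟨ b ⟩ - α⟨ a ⟩) (¬X-between a b εa≡εb)
              (¬X-between α⟨ a ⟩ β⟨ b ⟩ (trans (ε-twist _ a) (trans εa≡εb (sym (ε-twist _ b)))))
              (Sum.map shifted-by shifted-by (δ-gap-≡ (ε a)))
        where
          shifted-by : ∀ {g} → δ (ε a ⁻¹) - δ (ε a) ≡ g → β⟨ b ⟩ - α⟨ a ⟩ ≡ (b - a) + g
          shifted-by {g} δ-gap≡g = begin
            β⟨ b ⟩ - α⟨ a ⟩                  ≡⟨ gap a b _ _ ⟩
            (b - a) + (δ (ε b ⁻¹) - δ (ε a)) ≡⟨ cong (λ p → (b - a) + (δ (p ⁻¹) - δ (ε a))) εa≡εb ⟨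
            (b - a) + (δ (ε a ⁻¹) - δ (ε a)) ≡⟨ cong ((b - a) +_) δ-gap≡g ⟩
            (b - a) + g                      ∎
            where open ≡-Reasoning

    parityTwist⇒unstable : Unstable (Cayley S)
    parityTwist⇒unstable = twoFoldAut⇒unstable (Cayley-sym S-inv) (record { α = α ; β = β ; preserve = preserve }) 0#
      (δ-distinct (ε 0#) ∘ ∙-cancelˡ 0# _ _)

-- The cyclic group ℤ₂ₘ and its subgroups

module ℤ₂ₘ (m : ℕ) .{{_ : NonZero m}} where

  open import Data.Nat using (_+_)

  n : ℕ
  n = 2 * m

  instance
    n-nonZero : NonZero n
    n-nonZero = m*n≢0 2 m

  [_] : ℕ → ℤ₂ₘ m
  [_] = ⟦_⟧ m

  infixl 6 _+ₘ_
  _+ₘ_ : ℤ₂ₘ m → ℤ₂ₘ m → ℤ₂ₘ m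
  _+ₘ_ = add m

  toℕ-[] : ∀ k → toℕ [ k ] ≡ k % n
  toℕ-[] k = toℕ-fromℕ< (m%n<n k n)

  []-cong-% : ∀ {a b} → a % n ≡ b % n → [ a ] ≡ [ b ]
  []-cong-% {a} {b} eq = toℕ-injective (trans (toℕ-[] a) (trans eq (sym (toℕ-[] b))))

  []-toℕ : ∀ x → [ toℕ x ] ≡ x
  []-toℕ x = toℕ-injective (trans (toℕ-[] (toℕ x)) (m<n⇒m%n≡m (toℕ<n x)))

  []-+ : ∀ a b → [ a ] +ₘ [ b ] ≡ [ a + b ]
  []-+ a b = []-cong-% (begin
    (toℕ [ a ] + toℕ [ b ]) % n ≡⟨ cong₂ (λ u v → (u + v) % n) (toℕ-[] a) (toℕ-[] b) ⟩
    (a % n + b % n) % n         ≡⟨ %-distribˡ-+ a b n ⟨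
    (a + b) % n                 ∎)
    where open ≡-Reasoning

  [n]≡0 : [ n ] ≡ 0ₘ m
  [n]≡0 = []-cong-% (trans (n%n≡0 n) (sym (m<n⇒m%n≡m (>-nonZero⁻¹ n))))

  +ₘ-assoc : ∀ x y z → (x +ₘ y) +ₘ z ≡ x +ₘ (y +ₘ z)
  +ₘ-assoc x y z = begin
    (x +ₘ y) +ₘ z                  ≡⟨ cong ((x +ₘ y) +ₘ_) ([]-toℕ z) ⟨
    [ toℕ x + toℕ y ] +ₘ [ toℕ z ] ≡⟨ []-+ (toℕ x + toℕ y) (toℕ z) ⟩
    [ toℕ x + toℕ y + toℕ z ]      ≡⟨ cong [_] (+-assoc (toℕ x) (toℕ y) (toℕ z)) ⟩
    [ toℕ x + (toℕ y + toℕ z) ]    ≡⟨ []-+ (toℕ x) (toℕ y + toℕ z) ⟨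
    [ toℕ x ] +ₘ [ toℕ y + toℕ z ] ≡⟨ cong (_+ₘ (y +ₘ z)) ([]-toℕ x) ⟩
    x +ₘ (y +ₘ z)                  ∎
    where open ≡-Reasoning

  +ₘ-comm : ∀ x y → x +ₘ y ≡ y +ₘ x
  +ₘ-comm x y = cong [_] (+-comm (toℕ x) (toℕ y))

  +ₘ-identityʳ : ∀ x → x +ₘ 0ₘ m ≡ x
  +ₘ-identityʳ x = begin
    x +ₘ [ 0 ]         ≡⟨ cong (_+ₘ [ 0 ]) ([]-toℕ x) ⟨
    [ toℕ x ] +ₘ [ 0 ] ≡⟨ []-+ (toℕ x) 0 ⟩
    [ toℕ x + 0 ]      ≡⟨ cong [_] (+-identityʳ (toℕ x)) ⟩
    [ toℕ x ]          ≡⟨ []-toℕ x ⟩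
    x                  ∎
    where open ≡-Reasoning

  +ₘ-inverseʳ : ∀ x → x +ₘ neg m x ≡ 0ₘ m
  +ₘ-inverseʳ x = begin
    x +ₘ [ n ∸ toℕ x ]         ≡⟨ cong (_+ₘ [ n ∸ toℕ x ]) ([]-toℕ x) ⟨
    [ toℕ x ] +ₘ [ n ∸ toℕ x ] ≡⟨ []-+ (toℕ x) (n ∸ toℕ x) ⟩
    [ toℕ x + (n ∸ toℕ x) ]    ≡⟨ cong [_] (m+[n∸m]≡n (<⇒≤ (toℕ<n x))) ⟩
    [ n ]                      ≡⟨ [n]≡0 ⟩
    0ₘ m                       ∎
    where open ≡-Reasoning

  isAbelianGroup : IsAbelianGroup _≡_ (add m) (0ₘ m) (neg m)
  isAbelianGroup = record
    { isGroup = record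
      { isMonoid = record
        { isSemigroup = record
          { isMagma = record { isEquivalence = isEquivalence ; ∙-cong = cong₂ _+ₘ_ }
          ; assoc   = +ₘ-assoc
          }
        ; identity = comm∧idʳ⇒id +ₘ-comm +ₘ-identityʳ
        }
      ; inverse = comm∧invʳ⇒inv +ₘ-comm +ₘ-inverseʳ
      ; ⁻¹-cong = cong (neg m)
      }
    ; comm = +ₘ-comm
    }

  abelianGroup : AbelianGroup 0ℓ 0ℓ
  abelianGroup = record { isAbelianGroup = isAbelianGroup }

  open AbelianGroupProperties abelianGroup using (x≈z//y; //-rightDividesʳ)

  mₘ+mₘ≡0 : mₘ m +ₘ mₘ m ≡ 0ₘ m
  mₘ+mₘ≡0 = trans ([]-+ m m) (trans (cong (λ k → [ m + k ]) (sym (+-identityʳ m))) [n]≡0)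

  mₘ≢0 : mₘ m ≢ 0ₘ m
  mₘ≢0 mₘ≡0 = ≢-nonZero⁻¹ m (begin
    m          ≡⟨ m<n⇒m%n≡m (subst (m <_) (*-comm m 2) (m<m*n m 2 (s≤s (s≤s z≤n)))) ⟨
    m % n      ≡⟨ toℕ-[] m ⟨
    toℕ (mₘ m) ≡⟨ cong toℕ mₘ≡0 ⟩
    toℕ (0ₘ m) ≡⟨ toℕ-[] 0 ⟩
    0 % n      ≡⟨ m<n⇒m%n≡m (>-nonZero⁻¹ n) ⟩
    0          ∎)
    where open ≡-Reasoning

  _generates_ : ℕ → Subset n → Set
  d generates K = ∀ k → [ k ] ∈ K ⇔ d ∣ k

  generates⇒∈⇔∣ : ∀ {d K} → d generates K → ∀ x → x ∈ K ⇔ d ∣ toℕ x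
  generates⇒∈⇔∣ {d} {K} gen x = subst (λ y → y ∈ K ⇔ d ∣ toℕ x) ([]-toℕ x) (gen (toℕ x))

  [n]∈subgroup : ∀ {K} → IsSubgroup m K → [ n ] ∈ K
  [n]∈subgroup {K} (0∈K , _) = subst (_∈ K) (sym [n]≡0) 0∈K

  least-positive-generates : ∀ {K d} → IsSubgroup m K → 0 < d → [ d ] ∈ K →
    (∀ {j} → j < d → ¬ (0 < j × [ j ] ∈ K)) → d generates K
  least-positive-generates {K} {d} (0∈K , +-closed , neg-closed) 0<d [d]∈K minimal k = mk⇔ ∈K⇒d∣ d∣⇒∈K
    where
      instance
        d-nonZero : NonZero d
        d-nonZero = >-nonZero 0<d

      multiple∈K : ∀ q → [ q * d ] ∈ K
      multiple∈K zero    = 0∈K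
      multiple∈K (suc q) = subst (_∈ K) ([]-+ d (q * d)) (+-closed _ _ [d]∈K (multiple∈K q))

      d∣⇒∈K : d ∣ k → [ k ] ∈ K
      d∣⇒∈K (divides-refl q) = multiple∈K q

      [r]≡[k]-[qd] : [ k % d ] ≡ [ k ] +ₘ neg m [ k / d * d ]
      [r]≡[k]-[qd] = x≈z//y _ _ _ (trans ([]-+ (k % d) (k / d * d)) (cong [_] (sym (m≡m%n+[m/n]*n k d))))

      ∈K⇒d∣ : [ k ] ∈ K → d ∣ k
      ∈K⇒d∣ [k]∈K = m%n≡0⇒n∣m k d (remainder≡0 (k % d) refl [r]∈K)
        where
          [r]∈K : [ k % d ] ∈ K
          [r]∈K = subst (_∈ K) (sym [r]≡[k]-[qd]) (+-closed _ _ [k]∈K (neg-closed _ (multiple∈K (k / d))))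

          remainder≡0 : ∀ r → k % d ≡ r → [ r ] ∈ K → r ≡ 0
          remainder≡0 zero    _   _     = refl
          remainder≡0 (suc r) r≡ [r]∈K′ = ⊥-elim (minimal (subst (_< d) r≡ (m%n<n k d)) (s≤s z≤n , [r]∈K′))

  divisor-nonZero : ∀ N {d} → n ≡ N * d → NonZero d
  divisor-nonZero N n≡Nd = m*n≢0⇒n≢0 N {{subst NonZero n≡Nd n-nonZero}}

  record Cyclic (K : Subset n) : Set where
    field
      generator order : ℕ
      n≡order*generator : n ≡ order * generator
      membership : generator generates K

  -- opaque, so that type checking never unfolds the well-founded search for the generator
  opaque
    subgroup⇒cyclic : ∀ {K} → IsSubgroup m K → Cyclic K
    subgroup⇒cyclic {K} K-subgroup
      with least-witness (λ j → (0 <? j) ×-dec ([ j ] ∈? K)) (>-nonZero⁻¹ n , [n]∈subgroup K-subgroup)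
    ... | d , (0<d , [d]∈K) , minimal = record
      { generator         = d
      ; order             = _∣_.quotient d∣n
      ; n≡order*generator = _∣_.equality d∣n
      ; membership        = generates
      }
      where
        generates : d generates K
        generates = least-positive-generates K-subgroup 0<d [d]∈K minimal

        d∣n : d ∣ n
        d∣n = Equivalence.to (generates n) ([n]∈subgroup K-subgroup)

  ∣cyclic∣ : ∀ {K} (C : Cyclic K) → ∣ K ∣ ≡ Cyclic.order C
  ∣cyclic∣ {K} C = Multiples.∣multiples∣ generator {{divisor-nonZero order n≡order*generator}}
                     order n≡order*generator K (generates⇒∈⇔∣ membership)
    where open Cyclic C

  module BlockParity {K : Subset n} (C : Cyclic K) (N-even : parity (Cyclic.order C) ≡ 0ℙ) where

    open Cyclic C renaming (generator to d; order to N; n≡order*generator to n≡Nd)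

    instance
      d-nonZero : NonZero d
      d-nonZero = divisor-nonZero N n≡Nd

    blockParity : ℤ₂ₘ m → Parity
    blockParity a = parity (toℕ a / d)

    [u+qd]/d : ∀ u q → (u + q * d) / d ≡ u / d + q
    [u+qd]/d u q = trans (+-distrib-/-∣ʳ u {d = d} (n∣m*n q)) (cong (u / d +_) (m*n/n≡m q d))

    parity-[u%n]/d : ∀ u → parity ((u % n) / d) ≡ parity (u / d)
    parity-[u%n]/d u = sym (begin
      parity (u / d)                                        ≡⟨ cong (λ v → parity (v / d)) u≡u%n+[u/n*N]d ⟩
      parity ((u % n + u / n * N * d) / d)                  ≡⟨ cong parity ([u+qd]/d (u % n) (u / n * N)) ⟩
      parity ((u % n) / d + u / n * N)                      ≡⟨ +-homo-+ ((u % n) / d) (u / n * N) ⟩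
      parity ((u % n) / d) ℙ.+ parity (u / n * N)           ≡⟨ cong (parity ((u % n) / d) ℙ.+_) parity-u/n*N ⟩
      parity ((u % n) / d) ℙ.+ 0ℙ                           ≡⟨ ℙ+-identityʳ (parity ((u % n) / d)) ⟩
      parity ((u % n) / d)                                  ∎)
      where
        open ≡-Reasoning
        u≡u%n+[u/n*N]d : u ≡ u % n + u / n * N * d
        u≡u%n+[u/n*N]d = trans (m≡m%n+[m/n]*n u n) (cong (u % n +_) (trans (cong (u / n *_) n≡Nd) (sym (*-assoc (u / n) N d))))
        parity-u/n*N : parity (u / n * N) ≡ 0ℙ
        parity-u/n*N = trans (*-homo-* (u / n) N) (trans (cong (parity (u / n) ℙ.*_) N-even) (*-zeroʳ (parity (u / n))))

    blockParity-+ : ∀ a x q → toℕ x ≡ q * d → blockParity (a +ₘ x) ≡ blockParity a ℙ.+ parity q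
    blockParity-+ a x q x≡qd = begin
      parity (toℕ (a +ₘ x) / d)               ≡⟨ cong (λ v → parity (v / d)) (toℕ-[] (toℕ a + toℕ x)) ⟩
      parity (((toℕ a + toℕ x) % n) / d)      ≡⟨ parity-[u%n]/d (toℕ a + toℕ x) ⟩
      parity ((toℕ a + toℕ x) / d)            ≡⟨ cong (λ v → parity ((toℕ a + v) / d)) x≡qd ⟩
      parity ((toℕ a + q * d) / d)            ≡⟨ cong parity ([u+qd]/d (toℕ a) q) ⟩
      parity (toℕ a / d + q)                  ≡⟨ +-homo-+ (toℕ a / d) q ⟩
      blockParity a ℙ.+ parity q              ∎
      where open ≡-Reasoning

    even-shift-preserves : ∀ a x q → toℕ x ≡ q * d → parity q ≡ 0ℙ → blockParity (a +ₘ x) ≡ blockParity a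
    even-shift-preserves a x q x≡qd q-even =
      trans (blockParity-+ a x q x≡qd) (trans (cong (blockParity a ℙ.+_) q-even) (ℙ+-identityʳ (blockParity a)))

    Kₒ-flips : ∀ a x → Kₒ m K x → blockParity (a +ₘ x) ≢ blockParity a
    Kₒ-flips a x (x∈K , x∉2K) with Equivalence.to (generates⇒∈⇔∣ membership x) x∈K
    ... | divides q x≡qd = λ flipped → p≢p⁻¹ (blockParity a) (begin
      blockParity a             ≡⟨ flipped ⟨
      blockParity (a +ₘ x)      ≡⟨ blockParity-+ a x q x≡qd ⟩
      blockParity a ℙ.+ parity q ≡⟨ cong (blockParity a ℙ.+_) (2∤⇒parity≡1ℙ (x∉2K ∘ x∈2K)) ⟩
      blockParity a ℙ.+ 1ℙ      ≡⟨ ℙ+-comm (blockParity a) 1ℙ ⟩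
      blockParity a ⁻¹          ∎)
      where
        open ≡-Reasoning
        x∈2K : 2 ∣ q → Double m K x
        x∈2K (divides j q≡j*2) = [ j * d ] , Equivalence.from (membership (j * d)) (n∣m*n j) , (begin
          x                       ≡⟨ []-toℕ x ⟨
          [ toℕ x ]               ≡⟨ cong [_] (trans x≡qd (cong (_* d) (trans q≡j*2 (*-comm j 2)))) ⟩
          [ 2 * j * d ]           ≡⟨ cong [_] (trans (*-assoc 2 j d) (cong (j * d +_) (+-identityʳ (j * d)))) ⟩
          [ j * d + j * d ]       ≡⟨ []-+ (j * d) (j * d) ⟨
          [ j * d ] +ₘ [ j * d ]  ∎)

  odd-subgroup⊆2K : ∀ {K H} (CK : Cyclic K) (CH : Cyclic H) →
    parity (Cyclic.order CK) ≡ 0ℙ → parity (Cyclic.order CH) ≡ 1ℙ → H ⊆ K →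
    ∀ y → y ∈ H → ∃[ q ] (toℕ y ≡ q * Cyclic.generator CK × parity q ≡ 0ℙ)
  odd-subgroup⊆2K CK CH N-even M-odd H⊆K y y∈H =
    c * t , trans y≡ce (trans (cong (c *_) e≡td) (sym (*-assoc c t d))) ,
    trans (*-homo-* c t) (trans (cong (parity c ℙ.*_) t-even) (*-zeroʳ (parity c)))
    where
      open Cyclic CK renaming (generator to d; order to N; n≡order*generator to n≡Nd)
      open Cyclic CH using () renaming (generator to e; order to M; n≡order*generator to n≡Me; membership to H-membership)
      open _∣_ (Equivalence.to (membership e) (H⊆K (Equivalence.from (H-membership e) ∣-refl)))
        renaming (quotient to t; equality to e≡td)
      open _∣_ (Equivalence.to (generates⇒∈⇔∣ H-membership y) y∈H)
        renaming (quotient to c; equality to y≡ce)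

      instance
        d-nonZero : NonZero d
        d-nonZero = divisor-nonZero N n≡Nd

      N≡Mt : N ≡ M * t
      N≡Mt = *-cancelʳ-≡ N (M * t) d (begin
        N * d       ≡⟨ n≡Nd ⟨
        n           ≡⟨ n≡Me ⟩
        M * e       ≡⟨ cong (M *_) e≡td ⟩
        M * (t * d) ≡⟨ *-assoc M t d ⟨
        M * t * d   ∎)
        where open ≡-Reasoning

      t-even : parity t ≡ 0ℙ
      t-even = begin
        parity t                ≡⟨ cong (ℙ._* parity t) M-odd ⟨
        parity M ℙ.* parity t   ≡⟨ *-homo-* M t ⟨
        parity (M * t)          ≡⟨ cong parity N≡Mt ⟨
        parity N                ≡⟨ N-even ⟩
        0ℙ                      ∎
        where open ≡-Reasoning

  open CayleyGraphs isAbelianGroup using (parityTwist⇒unstable)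

  cond1⇒unstable : ∀ {S} → (∀ s → s ∈ S → neg m s ∈ S) → Cond1 m S → Unstable (CayS m S)
  cond1⇒unstable {S} S-inv (K , H , K-subgroup , K-even , H-subgroup , H⊆K , H-odd , (h , h∈H , h≢0) , S∖Kₒ-invariant) =
    parityTwist⇒unstable S-inv blockParity Kₒ-flips h h≢0 h-preserves S-+h
    where
      CK : Cyclic K
      CK = subgroup⇒cyclic K-subgroup

      CH : Cyclic H
      CH = subgroup⇒cyclic H-subgroup

      order-even : parity (Cyclic.order CK) ≡ 0ℙ
      order-even = 2∣⇒parity≡0ℙ (subst (2 ∣_) (∣cyclic∣ CK) K-even)

      H-order-odd : parity (Cyclic.order CH) ≡ 1ℙ
      H-order-odd = 2∤⇒parity≡1ℙ (H-odd ∘ subst (2 ∣_) (sym (∣cyclic∣ CH)))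

      open BlockParity CK order-even

      h-preserves : ∀ a → blockParity (a +ₘ h) ≡ blockParity a
      h-preserves a with odd-subgroup⊆2K CK CH order-even H-order-odd H⊆K h h∈H
      ... | q , h≡qd , q-even = even-shift-preserves a h q h≡qd q-even

      S-+h : ∀ x → ¬ Kₒ m K x → ¬ Kₒ m K (x +ₘ h) → x ∈ S ⇔ (x +ₘ h) ∈ S
      S-+h x x∉Kₒ x+h∉Kₒ = mk⇔
        (λ x∈S → proj₁ (Equivalence.to (S∖Kₒ-invariant _) (x , h , (x∈S , x∉Kₒ) , h∈H , refl)))
        (λ x+h∈S → subst (_∈ S) (//-rightDividesʳ h x)
          (proj₁ (Equivalence.to (S∖Kₒ-invariant _) (x +ₘ h , neg m h , (x+h∈S , x+h∉Kₒ) , proj₂ (proj₂ H-subgroup) h h∈H , refl))))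

open ℤ₂ₘ using (isAbelianGroup; mₘ+mₘ≡0; mₘ≢0; cond1⇒unstable)
open CayleyGraphs using (iso-Shifted⇒unstable; aut-Shifted⇒unstable)

theorem1p5 : (m : ℕ) → .{{_ : NonZero m}} → (S : Subset (2 * m)) → ConnectionSet m S → Cond1 m S ⊎ Cond2 m S ⊎ Cond3 m S → Unstable (CayS m S)
theorem1p5 m S (_ , S-inv) (inj₁ cond1) = cond1⇒unstable m S-inv cond1
theorem1p5 m S (_ , S-inv) (inj₂ (inj₁ φ)) =
  iso-Shifted⇒unstable (isAbelianGroup m) (mₘ m) (mₘ+mₘ≡0 m) S-inv (mₘ≢0 m) φ
theorem1p5 m S (_ , S-inv) (inj₂ (inj₂ (σ , σ0≡0 , σm≢m))) =
  aut-Shifted⇒unstable (isAbelianGroup m) (mₘ m) (mₘ+mₘ≡0 m) S-inv _≟_ σ σ0≡0 σm≢m
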